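{- Let $d\geq 1$, $m\geq 3$ and $s=2d+3$, and let $n$ be a positive multiple of $s$. Let $0\leq \ell<n$ and let $X=C_m\Box^{\sigma_\ell} C_n$ be the Cartesian graph bundle with base $C_m$, fibre $C_n$ and cyclic $\ell$-shift $\sigma_\ell$. Suppose that one of the following holds: (a) $\ell=[ks+(-1)^a 2dm]\bmod n$ for some $a\in\{1,2\}$ and $k\in\mathbb{Z}$; (b) $d=3t+2$ for some integer $t\geq 0$, and $\ell=[ks-(2t+3)(d+a)m]\bmod n$ for some $a\in\{1,2\}$ and $k\in\mathbb{Z}$; (c) $d=3t+1$ for some integer $t\geq 0$, and $\ell=[ks+(2t+1)(d+a)m]\bmod n$ for some $a\in\{1,2\}$ and $k\in\mathbb{Z}$; (d) $d=3t$ for some integer $t\geq 1$, $m=ps+3t'$ for some integer $p\geq 0$ and some $t'\in\{0,1,\dots,2t\}$, and $\ell=\left[ks+(r+a-1)\frac{s}{3}-(-1)^a t'\right]\bmod n$ for some $a\in\{1,2\}$, $k\in\mathbb{Z}$ and $r\in\{0,1,2\}$. Then $\lambda^d_1(X)\leq 2d+2$, and $\lambda^d_1(X)=2d+2$ if $1\leq d\leq 4$.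
   Context: For $n\geq 3$, the cycle $C_n$ has vertex set $\{0,1,\dots,n-1\}$ with $i$ adjacent to $j$ iff $i\equiv j\pm 1 \pmod n$. The cyclic $\ell$-shift is the automorphism $\sigma_\ell(j)=(j+\ell)\bmod n$ of $C_n$. The Cartesian graph bundle $C_m\Box^{\sigma_\ell}C_n$ has vertex set $\{0,\dots,m-1\}\times\{0,\dots,n-1\}$; for every $i$ and every edge $j_1j_2$ of $C_n$, $(i,j_1)$ and $(i,j_2)$ are adjacent; for $0\leq i\leq m-2$ and every $j$, $(i,j)$ and $(i+1,j)$ are adjacent; and for every $j$, $(m-1,j)$ and $(0,\sigma_\ell(j))$ are adjacent; there are no other edges. (For $\ell=0$ this is the Cartesian product $C_m\Box C_n$.) For an integer $d\geq 1$, an $L(d,1)$-labeling of a graph $G$ is a map $f:V(G)\to\{0,1,2,\dots\}$ such that $|f(u)-f(v)|\geq d$ whenever $u,v$ are adjacent and $|f(u)-f(v)|\geq 1$ whenever $u,v$ are at distance $2$ in $G$. $\lambda^d_1(G)$ is the least $\lambda$ such that $G$ admits an $L(d,1)$-labeling with labels in $\{0,1,\dots,\lambda\}$. -}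

module Defs where

open import Data.Nat using (ℕ; zero; suc; _+_; _*_; _≤_; ∣_-_∣; NonZero)
open import Data.Nat.DivMod using (_%_)
open import Data.Fin using (Fin; toℕ)
open import Data.Product using (Σ; ∃; _×_; _,_)
open import Data.Sum using (_⊎_)
open import Relation.Binary.PropositionalEquality using (_≡_; _≢_)
open import Relation.Nullary using (¬_)

CycAdj : (n : ℕ) .{{_ : NonZero n}} → ℕ → ℕ → Set
CycAdj n i j = (j ≡ suc i % n) ⊎ (i ≡ suc j % n)

BVertex : ℕ → ℕ → Set
BVertex m n = Fin m × Fin n

BundleAdj : (m n ℓ : ℕ) .{{_ : NonZero n}} → BVertex m n → BVertex m n → Set
BundleAdj m n ℓ (i₁ , j₁) (i₂ , j₂) =
    (toℕ i₁ ≡ toℕ i₂ × CycAdj n (toℕ j₁) (toℕ j₂))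
  ⊎
    (toℕ j₁ ≡ toℕ j₂ × (toℕ i₂ ≡ suc (toℕ i₁) ⊎ toℕ i₁ ≡ suc (toℕ i₂)))
  ⊎
    (suc (toℕ i₁) ≡ m × toℕ i₂ ≡ 0 × toℕ j₂ ≡ (toℕ j₁ + ℓ) % n)
  ⊎ (suc (toℕ i₂) ≡ m × toℕ i₁ ≡ 0 × toℕ j₁ ≡ (toℕ j₂ + ℓ) % n)

Dist2 : {V : Set} → (V → V → Set) → V → V → Set
Dist2 {V} Adj u v = u ≢ v × ¬ Adj u v × Σ V (λ w → Adj u w × Adj w v)

IsLd1Labeling : {V : Set} → (V → V → Set) → ℕ → (V → ℕ) → Set
IsLd1Labeling {V} Adj d f =
    ((u v : V) → Adj u v → d ≤ ∣ f u - f v ∣)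
  × ((u v : V) → Dist2 Adj u v → 1 ≤ ∣ f u - f v ∣)

λ≤ : {V : Set} → (V → V → Set) → ℕ → ℕ → Set
λ≤ {V} Adj d bound = Σ (V → ℕ) (λ f → IsLd1Labeling Adj d f × ((v : V) → f v ≤ bound))

λ≡ : {V : Set} → (V → V → Set) → ℕ → ℕ → Set
λ≡ Adj d zero = λ≤ Adj d zero
λ≡ Adj d (suc b) = λ≤ Adj d (suc b) × ¬ λ≤ Adj d b

module Submission where

-- Write s = 2d + 3.  Upper bound: label (i , j) by (c₁ i + c₂ j) mod s.  A fibre edge
-- changes the label by ± c₂ and a base edge by ± c₁ (mod s); the edges closing the base
-- cycle also do so exactly when c₂ ℓ ≡ c₁ m (mod s), and each of (a)–(d) supplies such a
-- pair {c₁ , c₂} = {d , d + a}.  Then the four neighbours of a vertex with label x get the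
-- labels x + d , … , x + d + 3 (mod s) in some order: each lies at distance ≥ d from x and
-- no two coincide, which is all an L(d,1)-labeling asks of a 4-regular graph.
--
-- Lower bound: with labels in [0 , 2d + 1], every label carries four distinct labels at
-- distance ≥ d (those of its neighbours).  Such "roomy" labels are [0 , d − 2] and
-- [d + 3 , 2d + 1]; a roomy label x ≤ d − 2 then needs four distinct roomy labels in
-- [x + d , 2d + 1] ⊆ [d + 3 , 2d + 1], which has only d − 1 elements (symmetrically for
-- x ≥ d + 3).  So span 2d + 1 is impossible for d ≤ 4, which we check by enumeration.

open import Defs
open import Data.Nat using (ℕ; zero; suc; pred; _+_; _*_; _∸_; _≤_; _<_; _≤?_; _<?_; ∣_-_∣; NonZero; >-nonZero; >-nonZero⁻¹; z≤n; s≤s)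
open import Data.Nat.Properties
open import Data.Nat.DivMod using (_%_; _/_; %-distribˡ-+; %-distribˡ-*; m%n%n≡m%n; [m+n]%n≡m%n; [m+kn]%n≡m%n; m%n<n; m<n⇒m%n≡m; m≤n⇒[n∸m]%m≡n%m; m∣n⇒o%n%m≡o%m; m*n/n≡m)
open import Data.Nat.Divisibility using (_∣_; divides; ∣⇒≤)
open import Data.Nat.Tactic.RingSolver using (solve; solve-∀)
open import Data.Integer using (ℤ; +_; -[1+_]; -1ℤ; _^_; -_) renaming (_+_ to _+ℤ_; _*_ to _*ℤ_; _-_ to _-ℤ_)
open import Data.Integer.DivMod using (_%ℕ_; _/ℕ_; a≡a%ℕn+[a/ℕn]*n)
open import Data.Integer.Properties using (pos-*; +-injective)
import Data.Integer.Tactic.RingSolver as ℤ-Solver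
open import Data.Fin using (Fin; toℕ; fromℕ<) renaming (zero to fzero; suc to fsuc)
open import Data.Fin.Properties using (toℕ-injective; toℕ<n; toℕ-fromℕ<; pigeonhole) renaming (<⇒≢ to <⇒≢ᶠ; _≟_ to _≟ᶠ_)
open import Data.List using (List; _∷_; []; length; filter; upTo; lookup)
open import Data.List.Membership.Propositional using (_∈_)
open import Data.List.Membership.Propositional.Properties using (∈-filter⁺; ∈-upTo⁺)
open import Data.List.Relation.Unary.All as All using (All; all?)
open import Data.List.Relation.Unary.Any using (index)
open import Data.List.Relation.Unary.Any.Properties using (lookup-index)
open import Data.Product using (Σ; _×_; _,_; proj₁; proj₂)
open import Data.Sum using (_⊎_; inj₁; inj₂)
open import Data.Empty using (⊥-elim)
open import Function using (_∘_)
open import Function.Definitions using (Injective)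
open import Relation.Nullary using (¬_; Dec; yes; no; contradiction)
open import Relation.Nullary.Decidable using (_×-dec_; from-yes)
open import Relation.Binary.PropositionalEquality

-- Arithmetic modulo s on ℕ

module _ {s : ℕ} .{{_ : NonZero s}} where

  [m%o+n]%o≡[m+n]%o : ∀ a b → (a % s + b) % s ≡ (a + b) % s
  [m%o+n]%o≡[m+n]%o a b = begin
    (a % s + b) % s         ≡⟨ %-distribˡ-+ (a % s) b s ⟩
    (a % s % s + b % s) % s ≡⟨ cong (λ x → (x + b % s) % s) (m%n%n≡m%n a s) ⟩
    (a % s + b % s) % s     ≡⟨ %-distribˡ-+ a b s ⟨
    (a + b) % s             ∎
    where open ≡-Reasoning

  [m+n%o]%o≡[m+n]%o : ∀ a b → (a + b % s) % s ≡ (a + b) % s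
  [m+n%o]%o≡[m+n]%o a b = begin
    (a + b % s) % s ≡⟨ cong (_% s) (+-comm a (b % s)) ⟩
    (b % s + a) % s ≡⟨ [m%o+n]%o≡[m+n]%o b a ⟩
    (b + a) % s     ≡⟨ cong (_% s) (+-comm b a) ⟩
    (a + b) % s     ∎
    where open ≡-Reasoning

  +-congˡ-% : ∀ a {b b′} → b % s ≡ b′ % s → (a + b) % s ≡ (a + b′) % s
  +-congˡ-% a {b} {b′} b≡b′ = begin
    (a + b) % s      ≡⟨ [m+n%o]%o≡[m+n]%o a b ⟨
    (a + b % s) % s  ≡⟨ cong (λ x → (a + x) % s) b≡b′ ⟩
    (a + b′ % s) % s ≡⟨ [m+n%o]%o≡[m+n]%o a b′ ⟩
    (a + b′) % s     ∎
    where open ≡-Reasoning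

  %-add-complement : ∀ x {a b} → a + b ≡ s → ((x + a) % s + b) % s ≡ x % s
  %-add-complement x {a} {b} a+b≡s = begin
    ((x + a) % s + b) % s ≡⟨ [m%o+n]%o≡[m+n]%o (x + a) b ⟩
    (x + a + b) % s       ≡⟨ cong (_% s) (trans (+-assoc x a b) (cong (λ z → x + z) a+b≡s)) ⟩
    (x + s) % s           ≡⟨ [m+n]%n≡m%n x s ⟩
    x % s                 ∎
    where open ≡-Reasoning

  +-cancelʳ-% : ∀ {a b} x → a < s → b < s → (a + x) % s ≡ (b + x) % s → a ≡ b
  +-cancelʳ-% {a} {b} x a<s b<s eq = begin
    a                          ≡⟨ m<n⇒m%n≡m a<s ⟨
    a % s                      ≡⟨ undo a ⟨
    ((a + x′) % s + x̄) % s    ≡⟨ cong (λ y → (y + x̄) % s) reduced-eq ⟩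
    ((b + x′) % s + x̄) % s    ≡⟨ undo b ⟩
    b % s                      ≡⟨ m<n⇒m%n≡m b<s ⟩
    b                          ∎
    where
      open ≡-Reasoning
      x′ x̄ : ℕ
      x′ = x % s
      x̄ = s ∸ x % s
      undo : ∀ c → ((c + x′) % s + x̄) % s ≡ c % s
      undo c = %-add-complement c (m+[n∸m]≡n (<⇒≤ (m%n<n x s)))
      reduced-eq : (a + x′) % s ≡ (b + x′) % s
      reduced-eq = trans ([m+n%o]%o≡[m+n]%o a x) (trans eq (sym ([m+n%o]%o≡[m+n]%o b x)))

  +-cancelˡ-% : ∀ {a b} x → a < s → b < s → (x + a) % s ≡ (x + b) % s → a ≡ b
  +-cancelˡ-% {a} {b} x a<s b<s eq =
    +-cancelʳ-% x a<s b<s (trans (cong (_% s) (+-comm a x)) (trans eq (cong (_% s) (+-comm x b))))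

  -- Moving by c around a cycle of length s covers distance c or s − c.
  far-shift : ∀ {d c} x → x < s → d ≤ c → c + d ≤ s → d ≤ ∣ x - (x + c) % s ∣
  far-shift {d} {c} x x<s d≤c c+d≤s with x + c <? s
  ... | yes x+c<s = subst (d ≤_) (sym dist) d≤c
    where
      dist : ∣ x - (x + c) % s ∣ ≡ c
      dist = trans (cong (λ y → ∣ x - y ∣) (m<n⇒m%n≡m x+c<s)) (∣m-m+n∣≡n x c)
  ... | no x+c≮s = subst (d ≤_) (sym dist) (m+n≤o⇒m≤o∸n d (subst (_≤ s) (+-comm c d) c+d≤s))
    where
      y : ℕ
      y = (x + c) % s
      s≤x+c : s ≤ x + c
      s≤x+c = ≮⇒≥ x+c≮s
      c≤s : c ≤ s
      c≤s = m+n≤o⇒m≤o c c+d≤s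
      y≡x+c∸s : y ≡ x + c ∸ s
      y≡x+c∸s = trans (sym (m≤n⇒[n∸m]%m≡n%m s≤x+c))
                  (m<n⇒m%n≡m (m<n+o⇒m∸n<o (x + c) s (+-mono-<-≤ x<s c≤s)))
      y+[s∸c]≡x : y + (s ∸ c) ≡ x
      y+[s∸c]≡x = +-cancelʳ-≡ c (y + (s ∸ c)) x (begin
        y + (s ∸ c) + c     ≡⟨ +-assoc y (s ∸ c) c ⟩
        y + (s ∸ c + c)     ≡⟨ cong (λ z → y + z) (m∸n+n≡m c≤s) ⟩
        y + s               ≡⟨ cong (_+ s) y≡x+c∸s ⟩
        x + c ∸ s + s       ≡⟨ m∸n+n≡m s≤x+c ⟩
        x + c               ∎)
        where open ≡-Reasoning
      dist : ∣ x - y ∣ ≡ s ∸ c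
      dist = trans (cong (λ z → ∣ z - y ∣) (sym y+[s∸c]≡x))
               (trans (∣-∣-comm (y + (s ∸ c)) y) (∣m-m+n∣≡n y (s ∸ c)))

  m∣n⇒[c*[x%n]]%m≡[c*x]%m : ∀ {n} .{{_ : NonZero n}} c x → s ∣ n → (c * (x % n)) % s ≡ (c * x) % s
  m∣n⇒[c*[x%n]]%m≡[c*x]%m {n} c x s∣n = begin
    (c * (x % n)) % s                 ≡⟨ %-distribˡ-* c (x % n) s ⟩
    ((c % s) * (x % n % s)) % s       ≡⟨ cong (λ y → ((c % s) * y) % s) (m∣n⇒o%n%m≡o%m s n x s∣n) ⟩
    ((c % s) * (x % s)) % s           ≡⟨ %-distribˡ-* c x s ⟨
    (c * x) % s                       ∎
    where open ≡-Reasoning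

≢⇒1≤∣-∣ : ∀ {x y} → x ≢ y → 1 ≤ ∣ x - y ∣
≢⇒1≤∣-∣ x≢y = n≢0⇒n>0 (x≢y ∘ ∣m-n∣≡0⇒m≡n)

-- Congruences of integers

record Congruent (s : ℕ) (A B : ℤ) : Set where
  constructor congruent
  field
    quotient : ℤ
    equation : A ≡ B +ℤ quotient *ℤ + s

Congruent-sym : ∀ {s A B} → Congruent s A B → Congruent s B A
Congruent-sym {s} {A} {B} (congruent K A≡) = congruent (- K) (begin
  B                                ≡⟨ shift-back B K (+ s) ⟩
  (B +ℤ K *ℤ + s) +ℤ (- K) *ℤ + s  ≡⟨ cong (λ X → X +ℤ (- K) *ℤ + s) A≡ ⟨
  A +ℤ (- K) *ℤ + s                ∎)
  where
    open ≡-Reasoning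
    shift-back : ∀ X K S → X ≡ (X +ℤ K *ℤ S) +ℤ (- K) *ℤ S
    shift-back = ℤ-Solver.solve-∀

Congruent-trans : ∀ {s A B C} → Congruent s A B → Congruent s B C → Congruent s A C
Congruent-trans {s} {A} {B} {C} (congruent K₁ A≡) (congruent K₂ B≡) = congruent (K₂ +ℤ K₁) (begin
  A                                 ≡⟨ A≡ ⟩
  B +ℤ K₁ *ℤ + s                    ≡⟨ cong (λ X → X +ℤ K₁ *ℤ + s) B≡ ⟩
  (C +ℤ K₂ *ℤ + s) +ℤ K₁ *ℤ + s     ≡⟨ regroup C K₂ K₁ (+ s) ⟩
  C +ℤ (K₂ +ℤ K₁) *ℤ + s            ∎)
  where
    open ≡-Reasoning
    regroup : ∀ X K L S → (X +ℤ K *ℤ S) +ℤ L *ℤ S ≡ X +ℤ (K +ℤ L) *ℤ S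
    regroup = ℤ-Solver.solve-∀

Congruent-*ˡ : ∀ {s A B} M → Congruent s A B → Congruent s (M *ℤ A) (M *ℤ B)
Congruent-*ˡ {s} {A} {B} M (congruent K A≡) = congruent (M *ℤ K) (trans (cong (M *ℤ_) A≡) (distrib M B K (+ s)))
  where
    distrib : ∀ M X K S → M *ℤ (X +ℤ K *ℤ S) ≡ M *ℤ X +ℤ (M *ℤ K) *ℤ S
    distrib = ℤ-Solver.solve-∀

%ℕ-congruent : ∀ {s n} .{{_ : NonZero n}} X → s ∣ n → Congruent s (+ (X %ℕ n)) X
%ℕ-congruent {s} {n} X (divides N n≡N*s) = congruent (- (X /ℕ n *ℤ + N)) (begin
  R                                             ≡⟨ shift-back R (X /ℕ n) (+ N) (+ s) ⟩
  (R +ℤ X /ℕ n *ℤ (+ N *ℤ + s)) +ℤ Q *ℤ + s     ≡⟨ cong (λ Y → Y +ℤ Q *ℤ + s) X≡ ⟨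
  X +ℤ Q *ℤ + s                                 ∎)
  where
    open ≡-Reasoning
    R Q : ℤ
    R = + (X %ℕ n)
    Q = - (X /ℕ n *ℤ + N)
    X≡ : X ≡ R +ℤ X /ℕ n *ℤ (+ N *ℤ + s)
    X≡ = trans (a≡a%ℕn+[a/ℕn]*n X n)
           (cong (λ Y → R +ℤ X /ℕ n *ℤ Y) (trans (cong +_ n≡N*s) (pos-* N s)))
    shift-back : ∀ Y P M S → Y ≡ (Y +ℤ P *ℤ (M *ℤ S)) +ℤ (- (P *ℤ M)) *ℤ S
    shift-back = ℤ-Solver.solve-∀

module _ {s : ℕ} .{{_ : NonZero s}} where

  private
    +-congruent⇒%≡ : ∀ {a b} k → + a ≡ + b +ℤ + k *ℤ + s → a % s ≡ b % s
    +-congruent⇒%≡ {a} {b} k a≡ =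
      trans (cong (_% s) (+-injective (trans a≡ (cong (λ X → + b +ℤ X) (sym (pos-* k s))))))
            ([m+kn]%n≡m%n b k s)

  Congruent⇒%≡ : ∀ {a b} → Congruent s (+ a) (+ b) → a % s ≡ b % s
  Congruent⇒%≡ (congruent (+ k) a≡) = +-congruent⇒%≡ k a≡
  Congruent⇒%≡ (congruent -[1+ k ] a≡) =
    sym (+-congruent⇒%≡ (suc k) (Congruent.equation (Congruent-sym {s} (congruent -[1+ k ] a≡))))

-- If ℓ is read off an integer k s + u − v modulo a multiple n of s, then c₂ ℓ ≡ c₁ m (mod s)
-- reduces to an identity between natural numbers.
congruent-shift : ∀ {s n ℓ} .{{_ : NonZero n}} → s ∣ n → ∀ c₁ c₂ m k u v q₁ q₂
  → ℓ ≡ (k *ℤ + s +ℤ (+ u -ℤ + v)) %ℕ n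
  → c₂ * u + q₁ * s ≡ c₁ * m + c₂ * v + q₂ * s
  → Congruent s (+ (c₂ * ℓ)) (+ (c₁ * m))
congruent-shift {s} {n} {ℓ} s∣n c₁ c₂ m k u v q₁ q₂ ℓ≡ balance =
  subst (λ A → Congruent s A (+ (c₁ * m))) (sym (pos-* c₂ ℓ)) (Congruent-trans scaled shifted)
  where
    open ≡-Reasoning
    X : ℤ
    X = k *ℤ + s +ℤ (+ u -ℤ + v)
    scaled : Congruent s (+ c₂ *ℤ + ℓ) (+ c₂ *ℤ X)
    scaled = Congruent-*ˡ (+ c₂) (subst (λ y → Congruent s (+ y) X) (sym ℓ≡) (%ℕ-congruent X s∣n))
    balanceℤ : + c₂ *ℤ + u +ℤ + q₁ *ℤ + s ≡ + (c₁ * m) +ℤ + c₂ *ℤ + v +ℤ + q₂ *ℤ + s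
    balanceℤ = begin
      + c₂ *ℤ + u +ℤ + q₁ *ℤ + s               ≡⟨ cong₂ _+ℤ_ (pos-* c₂ u) (pos-* q₁ s) ⟨
      + (c₂ * u + q₁ * s)                      ≡⟨ cong +_ balance ⟩
      + (c₁ * m + c₂ * v + q₂ * s)             ≡⟨ cong₂ _+ℤ_ (cong (λ Y → + (c₁ * m) +ℤ Y) (pos-* c₂ v)) (pos-* q₂ s) ⟩
      + (c₁ * m) +ℤ + c₂ *ℤ + v +ℤ + q₂ *ℤ + s ∎
    expand : ∀ C k S U V Q → C *ℤ (k *ℤ S +ℤ (U -ℤ V)) ≡ (C *ℤ U +ℤ Q *ℤ S) -ℤ Q *ℤ S -ℤ C *ℤ V +ℤ C *ℤ k *ℤ S
    expand = ℤ-Solver.solve-∀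
    collect : ∀ M C V P Q k S → (M +ℤ C *ℤ V +ℤ Q *ℤ S) -ℤ P *ℤ S -ℤ C *ℤ V +ℤ C *ℤ k *ℤ S ≡ M +ℤ (C *ℤ k +ℤ Q -ℤ P) *ℤ S
    collect = ℤ-Solver.solve-∀
    shifted : Congruent s (+ c₂ *ℤ X) (+ (c₁ * m))
    shifted = congruent (+ c₂ *ℤ k +ℤ + q₂ -ℤ + q₁) (begin
      + c₂ *ℤ X
        ≡⟨ expand (+ c₂) k (+ s) (+ u) (+ v) (+ q₁) ⟩
      (+ c₂ *ℤ + u +ℤ + q₁ *ℤ + s) -ℤ + q₁ *ℤ + s -ℤ + c₂ *ℤ + v +ℤ + c₂ *ℤ k *ℤ + s
        ≡⟨ cong (λ Y → Y -ℤ + q₁ *ℤ + s -ℤ + c₂ *ℤ + v +ℤ + c₂ *ℤ k *ℤ + s) balanceℤ ⟩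
      (+ (c₁ * m) +ℤ + c₂ *ℤ + v +ℤ + q₂ *ℤ + s) -ℤ + q₁ *ℤ + s -ℤ + c₂ *ℤ + v +ℤ + c₂ *ℤ k *ℤ + s
        ≡⟨ collect (+ (c₁ * m)) (+ c₂) (+ v) (+ q₁) (+ q₂) k (+ s) ⟩
      + (c₁ * m) +ℤ (+ c₂ *ℤ k +ℤ + q₂ -ℤ + q₁) *ℤ + s
        ∎)

-- Adding c modulo s moves every label in [0 , s) by at least d.
FarShift : ℕ → ℕ → ℕ → Set
FarShift d s c = d ≤ c × c + d ≤ s

FarShift-complement : ∀ {d s c} → FarShift d s c → FarShift d s (s ∸ c)
FarShift-complement {d} {s} {c} (d≤c , c+d≤s) =
  m+n≤o⇒m≤o∸n d (subst (_≤ s) (+-comm c d) c+d≤s) ,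
  ≤-trans (+-monoʳ-≤ (s ∸ c) d≤c) (≤-reflexive (m∸n+n≡m (m+n≤o⇒m≤o c c+d≤s)))

≡∸⇒+≡ : ∀ {s c c′} → c ≤ s → c′ ≡ s ∸ c → c′ + c ≡ s
≡∸⇒+≡ {c = c} c≤s c′≡ = trans (cong (_+ c) c′≡) (m∸n+n≡m c≤s)

FarShift⇒< : ∀ {d s c} → 1 ≤ d → FarShift d s c → c < s
FarShift⇒< {c = c} 1≤d (_ , c+d≤s) = <-≤-trans (m<m+n c 1≤d) c+d≤s

-- The conditions making c₁, s − c₁, c₂, s − c₂ pairwise distinct far shifts.
record Admissible (d s c₁ c₂ : ℕ) : Set where
  field
    c₁-far  : FarShift d s c₁
    c₂-far  : FarShift d s c₂
    c₁≢c₂   : c₁ ≢ c₂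
    c₁+c₂≢s : c₁ + c₂ ≢ s
    c₁+c₁≢s : c₁ + c₁ ≢ s
    c₂+c₂≢s : c₂ + c₂ ≢ s

Admissible-swap : ∀ {d s c₁ c₂} → Admissible d s c₁ c₂ → Admissible d s c₂ c₁
Admissible-swap {c₁ = c₁} {c₂} adm = record
  { c₁-far  = c₂-far
  ; c₂-far  = c₁-far
  ; c₁≢c₂   = ≢-sym c₁≢c₂
  ; c₁+c₂≢s = c₁+c₂≢s ∘ trans (+-comm c₁ c₂)
  ; c₁+c₁≢s = c₂+c₂≢s
  ; c₂+c₂≢s = c₁+c₁≢s
  }
  where open Admissible adm

admissible-d+a : ∀ d {a} → 0 < a → a < 3 → a + a ≢ 3 → Admissible d (2 * d + 3) d (d + a)
admissible-d+a d {a} 0<a a<3 a+a≢3 = subst (λ s → Admissible d s d (d + a)) d+d+3≡2d+3 (record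
  { c₁-far  = ≤-refl , m≤m+n (d + d) 3
  ; c₂-far  = m≤m+n d a , subst (_≤ d + d + 3) d+d+a≡d+a+d (+-monoʳ-≤ (d + d) (<⇒≤ a<3))
  ; c₁≢c₂   = <⇒≢ (m<m+n d 0<a)
  ; c₁+c₂≢s = <⇒≢ a<3 ∘ +-cancelˡ-≡ (d + d) a 3 ∘ trans (+-assoc d d a)
  ; c₁+c₁≢s = <⇒≢ (m<m+n (d + d) (s≤s z≤n))
  ; c₂+c₂≢s = a+a≢3 ∘ +-cancelˡ-≡ (d + d) (a + a) 3 ∘ trans d+d+[a+a]≡[d+a]+[d+a]
  })
  where
    d+d+3≡2d+3 : d + d + 3 ≡ 2 * d + 3
    d+d+3≡2d+3 = solve (d ∷ [])
    d+d+a≡d+a+d : d + d + a ≡ d + a + d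
    d+d+a≡d+a+d = solve (d ∷ a ∷ [])
    d+d+[a+a]≡[d+a]+[d+a] : d + d + (a + a) ≡ (d + a) + (d + a)
    d+d+[a+a]≡[d+a]+[d+a] = solve (d ∷ a ∷ [])

admissible-pair : ∀ d {a} → a ≡ 1 ⊎ a ≡ 2 → Admissible d (2 * d + 3) d (d + a)
admissible-pair d (inj₁ refl) = admissible-d+a d (s≤s z≤n) (s≤s (s≤s z≤n)) (λ ())
admissible-pair d (inj₂ refl) = admissible-d+a d (s≤s z≤n) (s≤s (s≤s (s≤s z≤n))) (λ ())

-- Coefficients from the conditions (a)–(d) on ℓ

record Coefficients (d m ℓ : ℕ) : Set where
  constructor coefficients
  field
    c₁ c₂      : ℕ
    admissible : Admissible d (2 * d + 3) c₁ c₂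
    closing    : Congruent (2 * d + 3) (+ (c₂ * ℓ)) (+ (c₁ * m))

module _ (d m n ℓ : ℕ) .{{_ : NonZero n}} where

  Condition-a Condition-b Condition-c Condition-d : Set
  Condition-a =
    Σ ℕ (λ a → (a ≡ 1 ⊎ a ≡ 2) × Σ ℤ (λ k →
      ℓ ≡ (k *ℤ (+ (2 * d + 3)) +ℤ (-1ℤ ^ a) *ℤ (+ (2 * d * m))) %ℕ n))
  Condition-b =
    Σ ℕ (λ t → d ≡ 3 * t + 2 × Σ ℕ (λ a → (a ≡ 1 ⊎ a ≡ 2) × Σ ℤ (λ k →
      ℓ ≡ (k *ℤ (+ (2 * d + 3)) -ℤ (+ ((2 * t + 3) * (d + a) * m))) %ℕ n)))
  Condition-c =
    Σ ℕ (λ t → d ≡ 3 * t + 1 × Σ ℕ (λ a → (a ≡ 1 ⊎ a ≡ 2) × Σ ℤ (λ k →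
      ℓ ≡ (k *ℤ (+ (2 * d + 3)) +ℤ (+ ((2 * t + 1) * (d + a) * m))) %ℕ n)))
  Condition-d =
    Σ ℕ (λ t → 1 ≤ t × d ≡ 3 * t × Σ ℕ (λ p → Σ ℕ (λ t' → t' ≤ 2 * t
      × m ≡ p * (2 * d + 3) + 3 * t'
      × Σ ℕ (λ a → (a ≡ 1 ⊎ a ≡ 2) × Σ ℤ (λ k → Σ ℕ (λ r → r ≤ 2 ×
        ℓ ≡ (k *ℤ (+ (2 * d + 3)) +ℤ (+ ((r + a ∸ 1) * ((2 * d + 3) / 3)))
               -ℤ (-1ℤ ^ a) *ℤ (+ t')) %ℕ n))))))

balance-a₁ : ∀ d m → (d + 1) * 0 + d * m * (2 * d + 3) ≡ d * m + (d + 1) * (2 * d * m) + 0 * (2 * d + 3)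
balance-a₁ = solve-∀

balance-a₂ : ∀ d m → (d + 2) * (2 * d * m) + 0 * (2 * d + 3) ≡ d * m + (d + 2) * 0 + d * m * (2 * d + 3)
balance-a₂ = solve-∀

balance-b : ∀ d t a m → d ≡ 3 * t + 2
  → d * 0 + (d + a) * m * (t + 1) * (2 * d + 3) ≡ (d + a) * m + d * ((2 * t + 3) * (d + a) * m) + 0 * (2 * d + 3)
balance-b _ t a m refl = solve (t ∷ a ∷ m ∷ [])

balance-c : ∀ d t a m → d ≡ 3 * t + 1
  → d * ((2 * t + 1) * (d + a) * m) + 0 * (2 * d + 3) ≡ (d + a) * m + d * 0 + (d + a) * m * t * (2 * d + 3)
balance-c _ t a m refl = solve (t ∷ a ∷ m ∷ [])

[2*[3*t]+3]/3≡2*t+1 : ∀ t → (2 * (3 * t) + 3) / 3 ≡ 2 * t + 1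
[2*[3*t]+3]/3≡2*t+1 t = trans (cong (_/ 3) 2*[3*t]+3≡[2*t+1]*3) (m*n/n≡m (2 * t + 1) 3)
  where
    2*[3*t]+3≡[2*t+1]*3 : 2 * (3 * t) + 3 ≡ (2 * t + 1) * 3
    2*[3*t]+3≡[2*t+1]*3 = solve (t ∷ [])

balance-d₁ : ∀ d m t p t' r → d ≡ 3 * t → m ≡ p * (2 * d + 3) + 3 * t'
  → d * ((r + 1 ∸ 1) * ((2 * d + 3) / 3) + t') + ((d + 1) * p + t') * (2 * d + 3)
    ≡ (d + 1) * m + d * 0 + t * r * (2 * d + 3)
balance-d₁ _ _ t p t' r refl refl rewrite m+n∸n≡m r 1 | [2*[3*t]+3]/3≡2*t+1 t = solve (t ∷ p ∷ t' ∷ r ∷ [])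

balance-d₂ : ∀ d m t p t' r → d ≡ 3 * t → m ≡ p * (2 * d + 3) + 3 * t'
  → d * ((r + 2 ∸ 1) * ((2 * d + 3) / 3)) + ((d + 2) * p + 2 * t') * (2 * d + 3)
    ≡ (d + 2) * m + d * t' + t * (r + 1) * (2 * d + 3)
balance-d₂ _ _ t p t' r refl refl rewrite +-∸-assoc r {2} {1} (s≤s z≤n) | [2*[3*t]+3]/3≡2*t+1 t =
  solve (t ∷ p ∷ t' ∷ r ∷ [])

module _ {d m n ℓ : ℕ} .{{_ : NonZero n}} (s∣n : (2 * d + 3) ∣ n) where

  private
    reshape : ∀ {X Y} → ℓ ≡ X %ℕ n → X ≡ Y → ℓ ≡ Y %ℕ n
    reshape ℓ≡ X≡Y = trans ℓ≡ (cong (_%ℕ n) X≡Y)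

    shape-a₁ : ∀ k S P → k *ℤ S +ℤ (-1ℤ ^ 1) *ℤ P ≡ k *ℤ S +ℤ (+ 0 -ℤ P)
    shape-a₁ = ℤ-Solver.solve-∀
    shape-a₂ : ∀ k S P → k *ℤ S +ℤ (-1ℤ ^ 2) *ℤ P ≡ k *ℤ S +ℤ (P -ℤ + 0)
    shape-a₂ = ℤ-Solver.solve-∀
    shape-b : ∀ k S P → k *ℤ S -ℤ P ≡ k *ℤ S +ℤ (+ 0 -ℤ P)
    shape-b = ℤ-Solver.solve-∀
    shape-c : ∀ k S P → k *ℤ S +ℤ P ≡ k *ℤ S +ℤ (P -ℤ + 0)
    shape-c = ℤ-Solver.solve-∀
    shape-d₁ : ∀ k S W T → k *ℤ S +ℤ W -ℤ (-1ℤ ^ 1) *ℤ T ≡ k *ℤ S +ℤ ((W +ℤ T) -ℤ + 0)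
    shape-d₁ = ℤ-Solver.solve-∀
    shape-d₂ : ∀ k S W T → k *ℤ S +ℤ W -ℤ (-1ℤ ^ 2) *ℤ T ≡ k *ℤ S +ℤ (W -ℤ T)
    shape-d₂ = ℤ-Solver.solve-∀

  coefficients-a : Condition-a d m n ℓ → Coefficients d m ℓ
  coefficients-a (_ , inj₁ refl , k , ℓ≡) = coefficients d (d + 1) (admissible-pair d (inj₁ refl))
    (congruent-shift s∣n d (d + 1) m k 0 (2 * d * m) (d * m) 0 (reshape ℓ≡ (shape-a₁ k _ _)) (balance-a₁ d m))
  coefficients-a (_ , inj₂ refl , k , ℓ≡) = coefficients d (d + 2) (admissible-pair d (inj₂ refl))
    (congruent-shift s∣n d (d + 2) m k (2 * d * m) 0 0 (d * m) (reshape ℓ≡ (shape-a₂ k _ _)) (balance-a₂ d m))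

  coefficients-b : Condition-b d m n ℓ → Coefficients d m ℓ
  coefficients-b (t , d≡ , a , a∈ , k , ℓ≡) =
    coefficients (d + a) d (Admissible-swap (admissible-pair d a∈))
      (congruent-shift s∣n (d + a) d m k 0 ((2 * t + 3) * (d + a) * m) ((d + a) * m * (t + 1)) 0
        (reshape ℓ≡ (shape-b k _ _)) (balance-b d t a m d≡))

  coefficients-c : Condition-c d m n ℓ → Coefficients d m ℓ
  coefficients-c (t , d≡ , a , a∈ , k , ℓ≡) =
    coefficients (d + a) d (Admissible-swap (admissible-pair d a∈))
      (congruent-shift s∣n (d + a) d m k ((2 * t + 1) * (d + a) * m) 0 0 ((d + a) * m * t)
        (reshape ℓ≡ (shape-c k _ _)) (balance-c d t a m d≡))

  coefficients-d : Condition-d d m n ℓ → Coefficients d m ℓ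
  coefficients-d (t , _ , d≡ , p , t' , _ , m≡ , _ , inj₁ refl , k , r , _ , ℓ≡) =
    coefficients (d + 1) d (Admissible-swap (admissible-pair d (inj₁ refl)))
      (congruent-shift s∣n (d + 1) d m k ((r + 1 ∸ 1) * ((2 * d + 3) / 3) + t') 0 ((d + 1) * p + t') (t * r)
        (reshape ℓ≡ (shape-d₁ k _ _ _)) (balance-d₁ d m t p t' r d≡ m≡))
  coefficients-d (t , _ , d≡ , p , t' , _ , m≡ , _ , inj₂ refl , k , r , _ , ℓ≡) =
    coefficients (d + 2) d (Admissible-swap (admissible-pair d (inj₂ refl)))
      (congruent-shift s∣n (d + 2) d m k ((r + 2 ∸ 1) * ((2 * d + 3) / 3)) t' ((d + 2) * p + 2 * t') (t * (r + 1))
        (reshape ℓ≡ (shape-d₂ k _ _ _)) (balance-d₂ d m t p t' r d≡ m≡))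

  choose-coefficients : Condition-a d m n ℓ ⊎ Condition-b d m n ℓ ⊎ Condition-c d m n ℓ ⊎ Condition-d d m n ℓ
    → Coefficients d m ℓ
  choose-coefficients (inj₁ h)                = coefficients-a h
  choose-coefficients (inj₂ (inj₁ h))         = coefficients-b h
  choose-coefficients (inj₂ (inj₂ (inj₁ h)))  = coefficients-c h
  choose-coefficients (inj₂ (inj₂ (inj₂ h)))  = coefficients-d h

-- Span 2d + 1 is too small when every vertex has four distinct neighbours

injective⇒≤length : ∀ {A : Set} {k} (xs : List A) (y : Fin k → A)
  → Injective _≡_ _≡_ y → (∀ i → y i ∈ xs) → k ≤ length xs
injective⇒≤length {k = k} xs y y-injective y∈xs with k ≤? length xs
... | yes k≤ = k≤
... | no k≰ with i , j , i<j , same-index ← pigeonhole (≰⇒> k≰) (index ∘ y∈xs) =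
  contradiction (y-injective (begin
    y i                          ≡⟨ lookup-index (y∈xs i) ⟩
    lookup xs (index (y∈xs i))   ≡⟨ cong (lookup xs) same-index ⟩
    lookup xs (index (y∈xs j))   ≡⟨ lookup-index (y∈xs j) ⟨
    y j                          ∎))
    (<⇒≢ᶠ i<j)
  where open ≡-Reasoning

far? : ∀ d x y → Dec (d ≤ ∣ x - y ∣)
far? d x y = d ≤? ∣ x - y ∣

farLabels : ℕ → ℕ → ℕ → List ℕ
farLabels d b x = filter (far? d x) (upTo (suc b))

roomyFar? : ∀ d b x y → Dec (d ≤ ∣ x - y ∣ × 4 ≤ length (farLabels d b y))
roomyFar? d b x y = far? d x y ×-dec 4 ≤? length (farLabels d b y)

roomyFarLabels : ℕ → ℕ → ℕ → List ℕ
roomyFarLabels d b x = filter (roomyFar? d b x) (upTo (suc b))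

few-roomy-far-labels : ∀ {d x} → 1 ≤ d → d ≤ 4 → x ≤ 2 * d + 1
  → length (roomyFarLabels d (2 * d + 1) x) < 4
few-roomy-far-labels {d} 1≤d d≤4 x≤b = All.lookup (enumerate d 1≤d d≤4) (∈-upTo⁺ (s≤s x≤b))
  where
    Few : ℕ → Set
    Few e = All (λ x → length (roomyFarLabels e (2 * e + 1) x) < 4) (upTo (suc (2 * e + 1)))
    few? : ∀ e → Dec (Few e)
    few? e = all? (λ x → length (roomyFarLabels e (2 * e + 1) x) <? 4) (upTo (suc (2 * e + 1)))
    enumerate : ∀ e → 1 ≤ e → e ≤ 4 → Few e
    enumerate 1 _ _ = from-yes (few? 1)
    enumerate 2 _ _ = from-yes (few? 2)
    enumerate 3 _ _ = from-yes (few? 3)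
    enumerate 4 _ _ = from-yes (few? 4)
    enumerate (suc (suc (suc (suc (suc _))))) _ (s≤s (s≤s (s≤s (s≤s ()))))

module _ {V : Set} (Adj : V → V → Set) (Adj-sym : ∀ {u v} → Adj u v → Adj v u) where

  labeling-separates-neighbours : ∀ {d f} → 1 ≤ d → IsLd1Labeling Adj d f
    → ∀ {w u v} → Adj w u → Adj w v → u ≢ v → f u ≢ f v
  labeling-separates-neighbours {d} {f} 1≤d (adjacent-far , distance-two) {w} {u} {v} wu wv u≢v fu≡fv =
    1≰0 (distance-two u v (u≢v , not-adjacent , w , Adj-sym wu , wv))
    where
      1≰0 : ¬ 1 ≤ ∣ f u - f v ∣
      1≰0 = subst (λ k → ¬ 1 ≤ k) (sym (m≡n⇒∣m-n∣≡0 fu≡fv)) (λ ())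
      not-adjacent : ¬ Adj u v
      not-adjacent uv = 1≰0 (≤-trans 1≤d (adjacent-far u v uv))

  no-labeling-of-span-2d+1 : (nbr : V → Fin 4 → V) → (∀ w i → Adj w (nbr w i))
    → (∀ w → Injective _≡_ _≡_ (nbr w)) → V
    → ∀ {d} → 1 ≤ d → d ≤ 4 → ¬ λ≤ Adj d (2 * d + 1)
  no-labeling-of-span-2d+1 nbr adjacent-nbr nbr-injective w₀ {d} 1≤d d≤4 (f , labeling , bounded) =
    <⇒≱ (few-roomy-far-labels 1≤d d≤4 (bounded w₀))
        (injective⇒≤length (roomyFarLabels d b (f w₀)) (f ∘ nbr w₀) (neighbour-labels-injective w₀) roomy-far-label)
    where
      b : ℕ
      b = 2 * d + 1
      neighbour-labels-injective : ∀ w → Injective _≡_ _≡_ (f ∘ nbr w)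
      neighbour-labels-injective w {i} {j} same with i ≟ᶠ j
      ... | yes i≡j = i≡j
      ... | no i≢j = contradiction same
        (labeling-separates-neighbours {f = f} 1≤d labeling (adjacent-nbr w i) (adjacent-nbr w j) (i≢j ∘ nbr-injective w))
      far : ∀ w i → d ≤ ∣ f w - f (nbr w i) ∣
      far w i = proj₁ labeling w (nbr w i) (adjacent-nbr w i)
      label∈ : ∀ v → f v ∈ upTo (suc b)
      label∈ v = ∈-upTo⁺ (s≤s (bounded v))
      roomy : ∀ w → 4 ≤ length (farLabels d b (f w))
      roomy w = injective⇒≤length (farLabels d b (f w)) (f ∘ nbr w) (neighbour-labels-injective w)
        (λ i → ∈-filter⁺ (far? d (f w)) (label∈ (nbr w i)) (far w i))
      roomy-far-label : ∀ i → f (nbr w₀ i) ∈ roomyFarLabels d b (f w₀)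
      roomy-far-label i = ∈-filter⁺ (roomyFar? d b (f w₀)) (label∈ (nbr w₀ i)) (far w₀ i , roomy (nbr w₀ i))

-- The bundle as a 4-regular graph

data Direction : Set where
  fibre⁺ fibre⁻ base⁺ base⁻ : Direction

opposite : Direction → Direction
opposite fibre⁺ = fibre⁻
opposite fibre⁻ = fibre⁺
opposite base⁺  = base⁻
opposite base⁻  = base⁺

direction : Fin 4 → Direction
direction fzero                      = fibre⁺
direction (fsuc fzero)               = fibre⁻
direction (fsuc (fsuc fzero))        = base⁺
direction (fsuc (fsuc (fsuc fzero))) = base⁻

direction-injective : Injective _≡_ _≡_ direction
direction-injective {i} {j} eq = trans (sym (index-direction i)) (trans (cong directionIndex eq) (index-direction j))
  where
    directionIndex : Direction → Fin 4
    directionIndex fibre⁺ = fzero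
    directionIndex fibre⁻ = fsuc fzero
    directionIndex base⁺  = fsuc (fsuc fzero)
    directionIndex base⁻  = fsuc (fsuc (fsuc fzero))
    index-direction : ∀ i → directionIndex (direction i) ≡ i
    index-direction fzero                      = refl
    index-direction (fsuc fzero)               = refl
    index-direction (fsuc (fsuc fzero))        = refl
    index-direction (fsuc (fsuc (fsuc fzero))) = refl

module Bundle (m n ℓ : ℕ) .{{_ : NonZero n}} where

  Vertex : Set
  Vertex = BVertex m n

  row : Vertex → ℕ
  row = toℕ ∘ proj₁

  FibreStep : Vertex → Vertex → Set
  FibreStep (i , j) (i′ , j′) = toℕ i ≡ toℕ i′ × toℕ j′ ≡ suc (toℕ j) % n

  BaseStep : Vertex → Vertex → Set
  BaseStep (i , j) (i′ , j′) =
      (toℕ j ≡ toℕ j′ × toℕ i′ ≡ suc (toℕ i))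
    ⊎ (suc (toℕ i) ≡ m × toℕ i′ ≡ 0 × toℕ j′ ≡ (toℕ j + ℓ) % n)

  Step : Direction → Vertex → Vertex → Set
  Step fibre⁺ u v = FibreStep u v
  Step fibre⁻ u v = FibreStep v u
  Step base⁺  u v = BaseStep u v
  Step base⁻  u v = BaseStep v u

  step-opposite : ∀ δ {u v} → Step δ u v → Step (opposite δ) v u
  step-opposite fibre⁺ p = p
  step-opposite fibre⁻ p = p
  step-opposite base⁺  p = p
  step-opposite base⁻  p = p

  adjacent⇒step : ∀ {u v} → BundleAdj m n ℓ u v → Σ Direction λ δ → Step δ u v
  adjacent⇒step (inj₁ (e , inj₁ c))                = fibre⁺ , e , c
  adjacent⇒step (inj₁ (e , inj₂ c))                = fibre⁻ , sym e , c
  adjacent⇒step (inj₂ (inj₁ (e , inj₁ c)))         = base⁺ , inj₁ (e , c)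
  adjacent⇒step (inj₂ (inj₁ (e , inj₂ c)))         = base⁻ , inj₁ (sym e , c)
  adjacent⇒step (inj₂ (inj₂ (inj₁ wrap)))          = base⁺ , inj₂ wrap
  adjacent⇒step (inj₂ (inj₂ (inj₂ wrap)))          = base⁻ , inj₂ wrap

  step⇒adjacent : ∀ δ {u v} → Step δ u v → BundleAdj m n ℓ u v
  step⇒adjacent fibre⁺ (e , c)            = inj₁ (e , inj₁ c)
  step⇒adjacent fibre⁻ (e , c)            = inj₁ (sym e , inj₂ c)
  step⇒adjacent base⁺  (inj₁ (e , c))     = inj₂ (inj₁ (e , inj₁ c))
  step⇒adjacent base⁺  (inj₂ wrap)        = inj₂ (inj₂ (inj₁ wrap))
  step⇒adjacent base⁻  (inj₁ (e , c))     = inj₂ (inj₁ (sym e , inj₂ c))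
  step⇒adjacent base⁻  (inj₂ wrap)        = inj₂ (inj₂ (inj₂ wrap))

  adjacent-sym : ∀ {u v} → BundleAdj m n ℓ u v → BundleAdj m n ℓ v u
  adjacent-sym uv with δ , p ← adjacent⇒step uv = step⇒adjacent (opposite δ) (step-opposite δ p)

  vertex-≡ : ∀ {u v : Vertex} → toℕ (proj₁ u) ≡ toℕ (proj₁ v) → toℕ (proj₂ u) ≡ toℕ (proj₂ v) → u ≡ v
  vertex-≡ i≡ j≡ = cong₂ _,_ (toℕ-injective i≡) (toℕ-injective j≡)

  step-functional : ∀ δ {w u v} → Step δ w u → Step δ w v → u ≡ v
  step-functional fibre⁺ (a , b) (a′ , b′) = vertex-≡ (trans (sym a) a′) (trans b (sym b′))
  step-functional fibre⁻ {u = _ , j} {_ , j′} (a , b) (a′ , b′) =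
    vertex-≡ (trans a (sym a′)) (+-cancelˡ-% 1 (toℕ<n j) (toℕ<n j′) (trans (sym b) b′))
  step-functional base⁺ (inj₁ (a , b)) (inj₁ (a′ , b′)) = vertex-≡ (trans b (sym b′)) (trans (sym a) a′)
  step-functional base⁺ {u = i , _} (inj₁ (_ , b)) (inj₂ (e , _)) = ⊥-elim (<-irrefl (trans b e) (toℕ<n i))
  step-functional base⁺ {v = i , _} (inj₂ (e , _)) (inj₁ (_ , b)) = ⊥-elim (<-irrefl (trans b e) (toℕ<n i))
  step-functional base⁺ (inj₂ (_ , b , c)) (inj₂ (_ , b′ , c′)) = vertex-≡ (trans b (sym b′)) (trans c (sym c′))
  step-functional base⁻ (inj₁ (a , b)) (inj₁ (a′ , b′)) = vertex-≡ (suc-injective (trans (sym b) b′)) (trans a (sym a′))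
  step-functional base⁻ (inj₁ (_ , b)) (inj₂ (_ , b′ , _)) = ⊥-elim (0≢1+n (trans (sym b′) b))
  step-functional base⁻ (inj₂ (_ , b , _)) (inj₁ (_ , b′)) = ⊥-elim (0≢1+n (trans (sym b) b′))
  step-functional base⁻ {u = _ , j} {_ , j′} (inj₂ (e , _ , c)) (inj₂ (e′ , _ , c′)) =
    vertex-≡ (suc-injective (trans e (sym e′))) (+-cancelʳ-% ℓ (toℕ<n j) (toℕ<n j′) (trans (sym c) c′))

  preimage-shift : ∀ c → c ≤ n → (j : Fin n) → Σ (Fin n) λ j′ → toℕ j ≡ (toℕ j′ + c) % n
  preimage-shift c c≤n j = fromℕ< (m%n<n (toℕ j + (n ∸ c)) n) , (begin
    toℕ j                            ≡⟨ m<n⇒m%n≡m (toℕ<n j) ⟨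
    toℕ j % n                        ≡⟨ %-add-complement (toℕ j) (m∸n+n≡m c≤n) ⟨
    ((toℕ j + (n ∸ c)) % n + c) % n  ≡⟨ cong (λ x → (x + c) % n) (toℕ-fromℕ< _) ⟨
    (toℕ (fromℕ< _) + c) % n         ∎)
    where open ≡-Reasoning

  module _ (0<m : 0 < m) (ℓ≤n : ℓ ≤ n) where

    private
      instance
        m-nonZero : NonZero m
        m-nonZero = >-nonZero 0<m

    neighbour : ∀ δ w → Σ Vertex (Step δ w)
    neighbour fibre⁺ (i , j) = (i , fromℕ< (m%n<n (suc (toℕ j)) n)) , refl , toℕ-fromℕ< _
    neighbour fibre⁻ (i , j) =
      (i , proj₁ back) , refl , trans (proj₂ back) (cong (_% n) (+-comm (toℕ (proj₁ back)) 1))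
      where
        back : Σ (Fin n) λ j′ → toℕ j ≡ (toℕ j′ + 1) % n
        back = preimage-shift 1 (>-nonZero⁻¹ n) j
    neighbour base⁺ (i , j) with suc (toℕ i) <? m
    ... | yes i+1<m = (fromℕ< i+1<m , j) , inj₁ (refl , toℕ-fromℕ< i+1<m)
    ... | no i+1≮m  = (fromℕ< 0<m , fromℕ< (m%n<n (toℕ j + ℓ) n)) ,
                      inj₂ (≤-antisym (toℕ<n i) (≮⇒≥ i+1≮m) , toℕ-fromℕ< 0<m , toℕ-fromℕ< _)
    neighbour base⁻ (i , j) with toℕ i in i≡
    ... | zero  = (fromℕ< last<m , proj₁ back) ,
                  inj₂ (trans (cong suc (toℕ-fromℕ< last<m)) (suc-pred m) , refl , proj₂ back)
      where
        back : Σ (Fin n) λ j′ → toℕ j ≡ (toℕ j′ + ℓ) % n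
        back = preimage-shift ℓ ℓ≤n j
        last<m : pred m < m
        last<m = ≤-reflexive (suc-pred m)
    ... | suc k = (fromℕ< k<m , j) , inj₁ (refl , cong suc (sym (toℕ-fromℕ< k<m)))
      where
        k<m : k < m
        k<m = <⇒≤ (subst (_< m) i≡ (toℕ<n i))

  module _ (3≤m : 3 ≤ m) (3≤n : 3 ≤ n) where

    private
      m≢1 : m ≢ 1
      m≢1 = >⇒≢ (≤-trans (s≤s (s≤s z≤n)) 3≤m)
      m≢2 : m ≢ 2
      m≢2 = >⇒≢ 3≤m

    BaseStep-row≢ : ∀ {u v} → BaseStep u v → row u ≢ row v
    BaseStep-row≢ {u} (inj₁ (_ , b)) e = <-irrefl (trans e b) (n<1+n (row u))
    BaseStep-row≢ (inj₂ (e₁ , e₂ , _)) e = m≢1 (trans (sym e₁) (cong suc (trans e e₂)))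

    FibreStep-asym : ∀ {u v} → FibreStep u v → ¬ FibreStep v u
    FibreStep-asym {_ , j} {_ , j′} (_ , b) (_ , b′) = 2≢0 (+-cancelʳ-% (toℕ j) 3≤n (≤-trans (s≤s z≤n) 3≤n) (begin
      (2 + toℕ j) % n               ≡⟨ [m+n%o]%o≡[m+n]%o 1 (suc (toℕ j)) ⟨
      (1 + suc (toℕ j) % n) % n     ≡⟨ cong (λ x → suc x % n) b ⟨
      suc (toℕ j′) % n              ≡⟨ b′ ⟨
      toℕ j                         ≡⟨ m<n⇒m%n≡m (toℕ<n j) ⟨
      (0 + toℕ j) % n               ∎))
      where
        open ≡-Reasoning
        2≢0 : 2 ≢ 0
        2≢0 ()

    BaseStep-asym : ∀ {u v} → BaseStep u v → ¬ BaseStep v u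
    BaseStep-asym {_} {v} (inj₁ (_ , b)) (inj₁ (_ , b′)) =
      <-irrefl (trans b (cong suc b′)) (m<n⇒m<1+n (n<1+n (row v)))
    BaseStep-asym (inj₁ (_ , b)) (inj₂ (e , c , _)) = m≢2 (trans (sym e) (cong suc (trans b (cong suc c))))
    BaseStep-asym (inj₂ (e , c , _)) (inj₁ (_ , b′)) = m≢2 (trans (sym e) (cong suc (trans b′ (cong suc c))))
    BaseStep-asym (inj₂ (_ , c , _)) (inj₂ (e′ , _ , _)) = m≢1 (trans (sym e′) (cong suc c))

    direction-unique : ∀ δ δ′ {w x} → Step δ w x → Step δ′ w x → δ ≡ δ′
    direction-unique fibre⁺ fibre⁺ _ _ = refl
    direction-unique fibre⁻ fibre⁻ _ _ = refl
    direction-unique base⁺  base⁺  _ _ = refl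
    direction-unique base⁻  base⁻  _ _ = refl
    direction-unique fibre⁺ fibre⁻ p q = ⊥-elim (FibreStep-asym p q)
    direction-unique fibre⁻ fibre⁺ p q = ⊥-elim (FibreStep-asym q p)
    direction-unique base⁺  base⁻  p q = ⊥-elim (BaseStep-asym p q)
    direction-unique base⁻  base⁺  p q = ⊥-elim (BaseStep-asym q p)
    direction-unique fibre⁺ base⁺  p q = ⊥-elim (BaseStep-row≢ q (proj₁ p))
    direction-unique fibre⁺ base⁻  p q = ⊥-elim (BaseStep-row≢ q (sym (proj₁ p)))
    direction-unique fibre⁻ base⁺  p q = ⊥-elim (BaseStep-row≢ q (sym (proj₁ p)))
    direction-unique fibre⁻ base⁻  p q = ⊥-elim (BaseStep-row≢ q (proj₁ p))
    direction-unique base⁺  fibre⁺ p q = ⊥-elim (BaseStep-row≢ p (proj₁ q))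
    direction-unique base⁺  fibre⁻ p q = ⊥-elim (BaseStep-row≢ p (sym (proj₁ q)))
    direction-unique base⁻  fibre⁺ p q = ⊥-elim (BaseStep-row≢ p (sym (proj₁ q)))
    direction-unique base⁻  fibre⁻ p q = ⊥-elim (BaseStep-row≢ p (proj₁ q))

  module Linear (d : ℕ) {s : ℕ} .{{_ : NonZero s}} (c₁ c₂ : ℕ) (1≤d : 1 ≤ d)
                (admissible : Admissible d s c₁ c₂) (s∣n : s ∣ n)
                (closing : (c₂ * ℓ) % s ≡ (c₁ * m) % s) where

    open Admissible admissible

    label : Vertex → ℕ
    label (i , j) = (c₁ * toℕ i + c₂ * toℕ j) % s

    label<s : ∀ v → label v < s
    label<s _ = m%n<n _ s

    private
      c₁≤s : c₁ ≤ s
      c₁≤s = m+n≤o⇒m≤o c₁ (proj₂ c₁-far)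
      c₂≤s : c₂ ≤ s
      c₂≤s = m+n≤o⇒m≤o c₂ (proj₂ c₂-far)

    label-fibreStep : ∀ {u v} → FibreStep u v → label v ≡ (label u + c₂) % s
    label-fibreStep {i , j} {i′ , j′} (i≡ , j′≡) = begin
      (c₁ * toℕ i′ + c₂ * toℕ j′) % s               ≡⟨ cong₂ (λ x y → (c₁ * x + c₂ * y) % s) (sym i≡) j′≡ ⟩
      (c₁ * toℕ i + c₂ * (suc (toℕ j) % n)) % s     ≡⟨ +-congˡ-% (c₁ * toℕ i) (m∣n⇒[c*[x%n]]%m≡[c*x]%m c₂ (suc (toℕ j)) s∣n) ⟩
      (c₁ * toℕ i + c₂ * suc (toℕ j)) % s           ≡⟨ cong (_% s) (step c₁ (toℕ i) c₂ (toℕ j)) ⟩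
      (c₁ * toℕ i + c₂ * toℕ j + c₂) % s            ≡⟨ [m%o+n]%o≡[m+n]%o _ c₂ ⟨
      ((c₁ * toℕ i + c₂ * toℕ j) % s + c₂) % s      ∎
      where
        open ≡-Reasoning
        step : ∀ a x b y → a * x + b * suc y ≡ a * x + b * y + b
        step = solve-∀

    label-baseStep : ∀ {u v} → BaseStep u v → label v ≡ (label u + c₁) % s
    label-baseStep {i , j} {i′ , j′} (inj₁ (j≡ , i′≡)) = begin
      (c₁ * toℕ i′ + c₂ * toℕ j′) % s               ≡⟨ cong₂ (λ x y → (c₁ * x + c₂ * y) % s) i′≡ (sym j≡) ⟩
      (c₁ * suc (toℕ i) + c₂ * toℕ j) % s           ≡⟨ cong (_% s) (step c₁ (toℕ i) c₂ (toℕ j)) ⟩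
      (c₁ * toℕ i + c₂ * toℕ j + c₁) % s            ≡⟨ [m%o+n]%o≡[m+n]%o _ c₁ ⟨
      ((c₁ * toℕ i + c₂ * toℕ j) % s + c₁) % s      ∎
      where
        open ≡-Reasoning
        step : ∀ a x b y → a * suc x + b * y ≡ a * x + b * y + a
        step = solve-∀
    label-baseStep {i , j} {i′ , j′} (inj₂ (i+1≡m , i′≡0 , j′≡)) = begin
      (c₁ * toℕ i′ + c₂ * toℕ j′) % s               ≡⟨ cong₂ (λ x y → (c₁ * x + c₂ * y) % s) i′≡0 j′≡ ⟩
      (c₁ * 0 + c₂ * ((toℕ j + ℓ) % n)) % s         ≡⟨ +-congˡ-% (c₁ * 0) (m∣n⇒[c*[x%n]]%m≡[c*x]%m c₂ (toℕ j + ℓ) s∣n) ⟩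
      (c₁ * 0 + c₂ * (toℕ j + ℓ)) % s               ≡⟨ cong (_% s) (expand c₁ c₂ (toℕ j) ℓ) ⟩
      (c₂ * toℕ j + c₂ * ℓ) % s                     ≡⟨ +-congˡ-% (c₂ * toℕ j) closing ⟩
      (c₂ * toℕ j + c₁ * m) % s                     ≡⟨ cong (λ x → (c₂ * toℕ j + c₁ * x) % s) i+1≡m ⟨
      (c₂ * toℕ j + c₁ * suc (toℕ i)) % s           ≡⟨ cong (_% s) (step c₁ (toℕ i) c₂ (toℕ j)) ⟩
      (c₁ * toℕ i + c₂ * toℕ j + c₁) % s            ≡⟨ [m%o+n]%o≡[m+n]%o _ c₁ ⟨
      ((c₁ * toℕ i + c₂ * toℕ j) % s + c₁) % s      ∎
      where
        open ≡-Reasoning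
        expand : ∀ a b x y → a * 0 + b * (x + y) ≡ b * x + b * y
        expand = solve-∀
        step : ∀ a x b y → b * y + a * suc x ≡ a * x + b * y + a
        step = solve-∀

    private
      label-backward : ∀ {u v c} → c ≤ s → label u ≡ (label v + c) % s → label v ≡ (label u + (s ∸ c)) % s
      label-backward {u} {v} {c} c≤s u≡ = begin
        label v                             ≡⟨ m<n⇒m%n≡m (label<s v) ⟨
        label v % s                         ≡⟨ %-add-complement (label v) (m+[n∸m]≡n c≤s) ⟨
        ((label v + c) % s + (s ∸ c)) % s   ≡⟨ cong (λ x → (x + (s ∸ c)) % s) u≡ ⟨
        (label u + (s ∸ c)) % s             ∎
        where open ≡-Reasoning

    shift : Direction → ℕ
    shift fibre⁺ = c₂
    shift fibre⁻ = s ∸ c₂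
    shift base⁺  = c₁
    shift base⁻  = s ∸ c₁

    label-step : ∀ δ {u v} → Step δ u v → label v ≡ (label u + shift δ) % s
    label-step fibre⁺ p = label-fibreStep p
    label-step fibre⁻ p = label-backward c₂≤s (label-fibreStep p)
    label-step base⁺  p = label-baseStep p
    label-step base⁻  p = label-backward c₁≤s (label-baseStep p)

    shift-far : ∀ δ → FarShift d s (shift δ)
    shift-far fibre⁺ = c₂-far
    shift-far fibre⁻ = FarShift-complement c₂-far
    shift-far base⁺  = c₁-far
    shift-far base⁻  = FarShift-complement c₁-far

    shift-injective : ∀ δ δ′ → shift δ ≡ shift δ′ → δ ≡ δ′
    shift-injective fibre⁺ fibre⁺ _ = refl
    shift-injective fibre⁻ fibre⁻ _ = refl
    shift-injective base⁺  base⁺  _ = refl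
    shift-injective base⁻  base⁻  _ = refl
    shift-injective fibre⁺ fibre⁻ e = ⊥-elim (c₂+c₂≢s (≡∸⇒+≡ c₂≤s e))
    shift-injective fibre⁻ fibre⁺ e = ⊥-elim (c₂+c₂≢s (≡∸⇒+≡ c₂≤s (sym e)))
    shift-injective base⁺  base⁻  e = ⊥-elim (c₁+c₁≢s (≡∸⇒+≡ c₁≤s e))
    shift-injective base⁻  base⁺  e = ⊥-elim (c₁+c₁≢s (≡∸⇒+≡ c₁≤s (sym e)))
    shift-injective fibre⁺ base⁺  e = ⊥-elim (c₁≢c₂ (sym e))
    shift-injective base⁺  fibre⁺ e = ⊥-elim (c₁≢c₂ e)
    shift-injective fibre⁻ base⁻  e = ⊥-elim (c₁≢c₂ (sym (∸-cancelˡ-≡ c₂≤s c₁≤s e)))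
    shift-injective base⁻  fibre⁻ e = ⊥-elim (c₁≢c₂ (∸-cancelˡ-≡ c₁≤s c₂≤s e))
    shift-injective base⁺  fibre⁻ e = ⊥-elim (c₁+c₂≢s (≡∸⇒+≡ c₂≤s e))
    shift-injective fibre⁻ base⁺  e = ⊥-elim (c₁+c₂≢s (≡∸⇒+≡ c₂≤s (sym e)))
    shift-injective fibre⁺ base⁻  e = ⊥-elim (c₁+c₂≢s (trans (+-comm c₁ c₂) (≡∸⇒+≡ c₁≤s e)))
    shift-injective base⁻  fibre⁺ e = ⊥-elim (c₁+c₂≢s (trans (+-comm c₁ c₂) (≡∸⇒+≡ c₁≤s (sym e))))

    same-label⇒same-vertex : ∀ δ δ′ {w u v} → Step δ w u → Step δ′ w v → label u ≡ label v → u ≡ v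
    same-label⇒same-vertex δ δ′ {w} p q same
      with refl ← shift-injective δ δ′
             (+-cancelˡ-% (label w) (FarShift⇒< 1≤d (shift-far δ)) (FarShift⇒< 1≤d (shift-far δ′))
               (trans (sym (label-step δ p)) (trans same (label-step δ′ q))))
      = step-functional δ p q

    label-is-L[d,1] : IsLd1Labeling (BundleAdj m n ℓ) d label
    label-is-L[d,1] = adjacent-far , distance-two-distinct
      where
        adjacent-far : ∀ u v → BundleAdj m n ℓ u v → d ≤ ∣ label u - label v ∣
        adjacent-far u v uv with δ , p ← adjacent⇒step uv =
          subst (λ y → d ≤ ∣ label u - y ∣) (sym (label-step δ p))
            (far-shift (label u) (label<s u) (proj₁ (shift-far δ)) (proj₂ (shift-far δ)))
        distance-two-distinct : ∀ u v → Dist2 (BundleAdj m n ℓ) u v → 1 ≤ ∣ label u - label v ∣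
        distance-two-distinct u v (u≢v , _ , w , uw , wv)
          with δ , p ← adjacent⇒step uw | δ′ , q ← adjacent⇒step wv =
          ≢⇒1≤∣-∣ (u≢v ∘ same-label⇒same-vertex (opposite δ) δ′ (step-opposite δ p) q)

    linear-labeling : ∀ b → s ≡ suc b → λ≤ (BundleAdj m n ℓ) d b
    linear-labeling b s≡1+b = label , label-is-L[d,1] , λ v → ≤-pred (subst (label v <_) s≡1+b (label<s v))

  no-labeling-of-span-2d+1-in-bundle : 3 ≤ m → 3 ≤ n → ℓ ≤ n → ∀ {d} → 1 ≤ d → d ≤ 4 → ¬ λ≤ (BundleAdj m n ℓ) d (2 * d + 1)
  no-labeling-of-span-2d+1-in-bundle 3≤m 3≤n ℓ≤n =
    no-labeling-of-span-2d+1 (BundleAdj m n ℓ) adjacent-sym nbr nbr-adjacent nbr-injective origin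
    where
      0<m : 0 < m
      0<m = ≤-trans (s≤s z≤n) 3≤m
      nbr : Vertex → Fin 4 → Vertex
      nbr w i = proj₁ (neighbour 0<m ℓ≤n (direction i) w)
      nbr-adjacent : ∀ w i → BundleAdj m n ℓ w (nbr w i)
      nbr-adjacent w i = step⇒adjacent (direction i) (proj₂ (neighbour 0<m ℓ≤n (direction i) w))
      nbr-injective : ∀ w → Injective _≡_ _≡_ (nbr w)
      nbr-injective w {i} {j} same = direction-injective (direction-unique 3≤m 3≤n (direction i) (direction j)
        (proj₂ (neighbour 0<m ℓ≤n (direction i) w))
        (subst (Step (direction j) w) (sym same) (proj₂ (neighbour 0<m ℓ≤n (direction j) w))))
      origin : Vertex
      origin = fromℕ< 0<m , fromℕ< (>-nonZero⁻¹ n)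


theorem2 : (d m n ℓ : ℕ) → .{{_ : NonZero n}} → 1 ≤ d → 3 ≤ m
    → (2 * d + 3) ∣ n → ℓ < n
    → ( -- (a)
        Σ ℕ (λ a → (a ≡ 1 ⊎ a ≡ 2) × Σ ℤ (λ k →
          ℓ ≡ (k *ℤ (+ (2 * d + 3)) +ℤ (-1ℤ ^ a) *ℤ (+ (2 * d * m))) %ℕ n))
      ⊎ -- (b)
        Σ ℕ (λ t → d ≡ 3 * t + 2 × Σ ℕ (λ a → (a ≡ 1 ⊎ a ≡ 2) × Σ ℤ (λ k →
          ℓ ≡ (k *ℤ (+ (2 * d + 3)) -ℤ (+ ((2 * t + 3) * (d + a) * m))) %ℕ n)))
      ⊎ -- (c)
        Σ ℕ (λ t → d ≡ 3 * t + 1 × Σ ℕ (λ a → (a ≡ 1 ⊎ a ≡ 2) × Σ ℤ (λ k →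
          ℓ ≡ (k *ℤ (+ (2 * d + 3)) +ℤ (+ ((2 * t + 1) * (d + a) * m))) %ℕ n)))
      ⊎ -- (d)
        Σ ℕ (λ t → 1 ≤ t × d ≡ 3 * t × Σ ℕ (λ p → Σ ℕ (λ t' → t' ≤ 2 * t
          × m ≡ p * (2 * d + 3) + 3 * t'
          × Σ ℕ (λ a → (a ≡ 1 ⊎ a ≡ 2) × Σ ℤ (λ k → Σ ℕ (λ r → r ≤ 2 ×
            ℓ ≡ (k *ℤ (+ (2 * d + 3)) +ℤ (+ ((r + a ∸ 1) * ((2 * d + 3) / 3)))
                   -ℤ (-1ℤ ^ a) *ℤ (+ t')) %ℕ n)))))))
    → λ≤ (BundleAdj m n ℓ) d (2 * d + 2)
      × (d ≤ 4 → λ≡ (BundleAdj m n ℓ) d (2 * d + 2))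
theorem2 d m n ℓ 1≤d 3≤m s∣n ℓ<n condition = upper , exact
  where
    instance
      s-nonZero : NonZero (2 * d + 3)
      s-nonZero = >-nonZero (≤-trans (s≤s z≤n) (m≤n+m 3 (2 * d)))
    open Coefficients (choose-coefficients {d} {m} {n} {ℓ} s∣n condition)
    upper : λ≤ (BundleAdj m n ℓ) d (2 * d + 2)
    upper = Bundle.Linear.linear-labeling m n ℓ d c₁ c₂ 1≤d admissible s∣n (Congruent⇒%≡ closing)
              (2 * d + 2) (+-suc (2 * d) 2)
    3≤n : 3 ≤ n
    3≤n = ≤-trans (m≤n+m 3 (2 * d)) (∣⇒≤ s∣n)
    2d+2≡1+[2d+1] : 2 * d + 2 ≡ suc (2 * d + 1)
    2d+2≡1+[2d+1] = +-suc (2 * d) 1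
    exact : d ≤ 4 → λ≡ (BundleAdj m n ℓ) d (2 * d + 2)
    exact d≤4 = subst (λ≡ (BundleAdj m n ℓ) d) (sym 2d+2≡1+[2d+1])
      ( subst (λ≤ (BundleAdj m n ℓ) d) 2d+2≡1+[2d+1] upper
      , Bundle.no-labeling-of-span-2d+1-in-bundle m n ℓ 3≤m 3≤n (<⇒≤ ℓ<n) 1≤d d≤4 )
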